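{- Let $\mathbf{z}\in\Sigma_3^\omega$ be an infinite rich word that is $7/3$-power-free and has prefix $001002$. Then $\mathbf{z}$ contains neither $12$ nor $21$ as a factor.
   Context: $\Sigma_3=\{0,1,2\}$. An infinite word is rich if every finite factor of length $m$ has $m+1$ distinct palindromic factors (including the empty word). A word is $\alpha$-power-free if no factor $w$ has a period $p$ with $|w|/p\ge\alpha$. -}

module Defs where

open import Data.Nat using (ℕ; zero; suc; _+_; _*_; _≤_; _<_)
open import Data.Fin using (Fin)
open import Data.Fin.Properties using () renaming (_≟_ to _≟F_)
open import Data.List using (List; []; _∷_; length; reverse; filter; deduplicate; concatMap; upTo; map; drop; take; tails; inits)
open import Data.List.Properties using (≡-dec)
open import Relation.Binary.PropositionalEquality using (_≡_)
open import Relation.Nullary using (¬_)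
open import Relation.Nullary.Decidable using (Dec)
open import Data.Product using (_×_)

Σ₃ : Set
Σ₃ = Fin 3

InfWord : Set
InfWord = ℕ → Σ₃

Word : Set
Word = List Σ₃

_≟W_ : (u v : Word) → Dec (u ≡ v)
_≟W_ = ≡-dec _≟F_

factor : InfWord → ℕ → ℕ → Word
factor z i zero    = []
factor z i (suc m) = z i ∷ factor z (suc i) m

factors : Word → List Word
factors w = [] ∷ concatMap (λ t → inits t) (tails w)

isPalindrome? : (w : Word) → Dec (reverse w ≡ w)
isPalindrome? w = reverse w ≟W w

palFactors : Word → List Word
palFactors w = deduplicate _≟W_ (filter isPalindrome? (factors w))

Rich : InfWord → Set
Rich z = ∀ i m → length (palFactors (factor z i m)) ≡ suc m

HasPeriod : InfWord → ℕ → ℕ → ℕ → Set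
HasPeriod z i n p = 1 ≤ p × (∀ k → k + p < n → z (i + k) ≡ z (i + k + p))

PowerFree7/3 : InfWord → Set
PowerFree7/3 z = ∀ i n p → HasPeriod z i n p → ¬ (7 * p ≤ 3 * n)

HasFactor : InfWord → Word → Set
HasFactor z w = Data.Product.∃ λ i → factor z i (length w) ≡ w

module Submission where

-- Each prefix of a rich word has a palindromic suffix that does not occur
-- earlier (otherwise appending a letter would not create a new palindrome).
-- Take the first occurrence x y of 12 or 21, at position I ≥ 5. The suffix y
-- already occurs in the prefix 001002, and a palindromic suffix of length ≥ 2
-- begins with y x: for length 2 this forces x = y, and otherwise y x is an
-- earlier occurrence of 12 or 21. So z[0..I+1] has no new palindromic suffix,
-- a contradiction.

open import Defs
open import Data.Fin using (zero; suc)
open import Data.Nat using (ℕ; zero; suc; _+_; _∸_; _≤_; _<_; s≤s; z≤n)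
open import Data.Nat.Properties
open import Data.Nat.Induction using (<-rec)
open import Data.List using (List; []; _∷_; _++_; length; reverse; filter; inits; tails; _∷ʳ_; [_]; initLast; _∷ʳ′_)
open import Data.List.Properties using (length-++; length-++-sucʳ; ++-identityʳ; ++-assoc; reverse-++; ∷-injective; ∷-injectiveʳ; ∷ʳ-injectiveˡ)
open import Data.List.Membership.Propositional using (_∈_; find; lose)
open import Data.List.Membership.Propositional.Properties
open import Data.List.Relation.Binary.Subset.Propositional using (_⊆_)
open import Data.List.Relation.Binary.Pointwise using (≡⇒Pointwise-≡; []; _∷_)
open import Data.List.Relation.Unary.Any using (here; there)
open import Data.List.Relation.Unary.All as All using ()
open import Data.List.Relation.Unary.AllPairs using ([]; _∷_)
open import Data.List.Relation.Unary.Unique.Propositional using (Unique)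
open import Data.List.Relation.Unary.Unique.DecPropositional.Properties using (deduplicate-!)
open import Data.Product using (_×_; _,_; proj₁; proj₂; ∃; ∃₂)
open import Data.Sum using (_⊎_; inj₁; inj₂)
open import Data.Empty using (⊥; ⊥-elim)
open import Relation.Nullary using (¬_; yes; no)
open import Relation.Binary.PropositionalEquality hiding ([_])

Palindrome : Word → Set
Palindrome w = reverse w ≡ w

∈-++-remove : ∀ {A : Set} (us : List A) {x v} vs → v ∈ us ++ x ∷ vs → x ≢ v → v ∈ us ++ vs
∈-++-remove []       vs (here refl) x≢v = ⊥-elim (x≢v refl)
∈-++-remove []       vs (there v∈)  x≢v = v∈
∈-++-remove (u ∷ us) vs (here eq)   x≢v = here eq
∈-++-remove (u ∷ us) vs (there v∈)  x≢v = there (∈-++-remove us vs v∈ x≢v)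

Unique-⊆⇒length-≤ : ∀ {A : Set} {xs ys : List A} → Unique xs → xs ⊆ ys → length xs ≤ length ys
Unique-⊆⇒length-≤ {xs = []}     _           _   = z≤n
Unique-⊆⇒length-≤ {xs = x ∷ xs} (x∉ ∷ uniq) sub with ∈-∃++ (sub (here refl))
... | us , vs , refl = subst (suc (length xs) ≤_) (sym (length-++-sucʳ us x vs))
  (s≤s (Unique-⊆⇒length-≤ uniq (λ v∈ → ∈-++-remove us vs (sub (there v∈)) (All.lookup x∉ v∈))))

∈-tails-++ : ∀ {A : Set} (p r : List A) → r ∈ tails (p ++ r)
∈-tails-++ []      []      = here refl
∈-tails-++ []      (x ∷ r) = here refl
∈-tails-++ (x ∷ p) r       = there (∈-tails-++ p r)

∈-inits-++ : ∀ {A : Set} (s q : List A) → s ∈ inits (s ++ q)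
∈-inits-++ []      q = here refl
∈-inits-++ (x ∷ s) q = there (∈-map⁺ (x ∷_) (∈-inits-++ s q))

∈-tails⁻ : ∀ {A : Set} {t : List A} u → t ∈ tails u → ∃ λ p → u ≡ p ++ t
∈-tails⁻ []      (here refl) = [] , refl
∈-tails⁻ (x ∷ u) (here refl) = [] , refl
∈-tails⁻ (x ∷ u) (there t∈) with ∈-tails⁻ u t∈
... | p , refl = x ∷ p , refl

∈-inits⁻ : ∀ {A : Set} {s : List A} t → s ∈ inits t → ∃ λ q → t ≡ s ++ q
∈-inits⁻ []      (here refl) = [] , refl
∈-inits⁻ (x ∷ t) (here refl) = x ∷ t , refl
∈-inits⁻ (x ∷ t) (there s∈) with ∈-map⁻ (x ∷_) s∈
... | s , s∈′ , refl with ∈-inits⁻ t s∈′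
... | q , refl = q , refl

∈-factors⁺ : ∀ p s q → s ∈ factors (p ++ s ++ q)
∈-factors⁺ p []      q = here refl
∈-factors⁺ p (x ∷ s) q = there (∈-concatMap⁺ inits (lose (∈-tails-++ p (x ∷ s ++ q)) (∈-inits-++ (x ∷ s) q)))

∈-factors⁻ : ∀ {s} u → s ∈ factors u → ∃₂ λ p q → u ≡ p ++ s ++ q
∈-factors⁻ u (here refl) = [] , u , refl
∈-factors⁻ u (there s∈) with find (∈-concatMap⁻ inits {xs = tails u} s∈)
... | t , t∈ , s∈t with ∈-tails⁻ u t∈ | ∈-inits⁻ t s∈t
... | p , refl | q , refl = p , q , refl

∈-factors-∷ʳ : ∀ {s} w a → s ∈ factors (w ∷ʳ a) → s ∈ factors w ⊎ ∃ λ p → p ++ s ≡ w ∷ʳ a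
∈-factors-∷ʳ {s} w a s∈ with ∈-factors⁻ (w ∷ʳ a) s∈
... | p , q , eq with initLast q
... | [] = inj₂ (p , sym (trans eq (cong (p ++_) (++-identityʳ s))))
... | q′ ∷ʳ′ b = inj₁ (subst (λ u → s ∈ factors u) (sym w≡) (∈-factors⁺ p s q′))
  where
  w≡ : w ≡ p ++ s ++ q′
  w≡ = ∷ʳ-injectiveˡ w (p ++ s ++ q′) (begin
    w ∷ʳ a                   ≡⟨ eq ⟩
    p ++ s ++ q′ ∷ʳ b        ≡⟨ cong (p ++_) (sym (++-assoc s q′ [ b ])) ⟩
    p ++ (s ++ q′) ∷ʳ b      ≡⟨ sym (++-assoc p (s ++ q′) [ b ]) ⟩
    (p ++ s ++ q′) ∷ʳ b      ∎)
    where open ≡-Reasoning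

palFactors-mono : ∀ u w → (∀ {s} → Palindrome s → s ∈ factors u → s ∈ factors w)
                → length (palFactors u) ≤ length (palFactors w)
palFactors-mono u w sub = Unique-⊆⇒length-≤ (deduplicate-! _≟W_ (filter isPalindrome? (factors u))) λ s∈ →
  let s∈u , pal = ∈-filter⁻ isPalindrome? (∈-deduplicate⁻ _≟W_ (filter isPalindrome? (factors u)) s∈)
  in ∈-deduplicate⁺ _≟W_ (∈-filter⁺ isPalindrome? (sub pal s∈u) pal)

palFactors-∷ʳ-≤ : ∀ w a → (∀ p s → p ++ s ≡ w ∷ʳ a → Palindrome s → s ∈ factors w)
                → length (palFactors (w ∷ʳ a)) ≤ length (palFactors w)
palFactors-∷ʳ-≤ w a old = palFactors-mono (w ∷ʳ a) w λ pal s∈ → case-factor pal (∈-factors-∷ʳ w a s∈)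
  where
  case-factor : ∀ {s} → Palindrome s → s ∈ factors w ⊎ ∃ (λ p → p ++ s ≡ w ∷ʳ a) → s ∈ factors w
  case-factor pal (inj₁ s∈w)       = s∈w
  case-factor pal (inj₂ (p , suf)) = old p _ suf pal

module _ (z : InfWord) where

  length-factor : ∀ i n → length (factor z i n) ≡ n
  length-factor i zero    = refl
  length-factor i (suc n) = cong suc (length-factor (suc i) n)

  factor-+ : ∀ i m n → factor z i (m + n) ≡ factor z i m ++ factor z (i + m) n
  factor-+ i zero    n = cong (λ k → factor z k n) (sym (+-identityʳ i))
  factor-+ i (suc m) n = cong (z i ∷_) (trans (factor-+ (suc i) m n) (cong (λ k → factor z (suc i) m ++ factor z k n) (sym (+-suc i m))))

  factor-suc : ∀ i n → factor z i (suc n) ≡ factor z i n ∷ʳ z (i + n)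
  factor-suc i n = trans (cong (factor z i) (+-comm 1 n)) (factor-+ i n 1)

  factor∈factors-prefix : ∀ j L n → j + L ≤ n → factor z j L ∈ factors (factor z 0 n)
  factor∈factors-prefix j L n j+L≤n = subst (λ u → factor z j L ∈ factors u) (sym prefix≡) (∈-factors⁺ (factor z 0 j) (factor z j L) (factor z (j + L) r))
    where
    open ≡-Reasoning
    r = n ∸ (j + L)
    prefix≡ : factor z 0 n ≡ factor z 0 j ++ factor z j L ++ factor z (j + L) r
    prefix≡ = begin
      factor z 0 n                                        ≡⟨ cong (factor z 0) (sym (m+[n∸m]≡n j+L≤n)) ⟩
      factor z 0 (j + L + r)                              ≡⟨ factor-+ 0 (j + L) r ⟩
      factor z 0 (j + L) ++ factor z (j + L) r            ≡⟨ cong (_++ factor z (j + L) r) (factor-+ 0 j L) ⟩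
      (factor z 0 j ++ factor z j L) ++ factor z (j + L) r ≡⟨ ++-assoc (factor z 0 j) _ _ ⟩
      factor z 0 j ++ factor z j L ++ factor z (j + L) r  ∎

  suffix-of-factor : ∀ p s i n → p ++ s ≡ factor z i n → s ≡ factor z (i + length p) (length s)
  suffix-of-factor []      s i n eq = trans eq (cong₂ (factor z) (sym (+-identityʳ i)) (sym (trans (cong length eq) (length-factor i n))))
  suffix-of-factor (x ∷ p) s i (suc n) eq =
    trans (suffix-of-factor p s (suc i) n (∷-injectiveʳ eq)) (cong (λ k → factor z k (length s)) (sym (+-suc i (length p))))

  palindrome-ends : ∀ j L → Palindrome (factor z j (suc (suc L))) → z (j + suc L) ≡ z j × z (j + L) ≡ z (suc j)
  palindrome-ends j L pal = let e₁ , eq = ∷-injective reversed≡ in e₁ , proj₁ (∷-injective eq)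
    where
    open ≡-Reasoning
    w = factor z j L
    reversed≡ : z (j + suc L) ∷ z (j + L) ∷ reverse w ≡ factor z j (suc (suc L))
    reversed≡ = begin
      z (j + suc L) ∷ z (j + L) ∷ reverse w             ≡⟨ cong (z (j + suc L) ∷_) (sym (reverse-++ w [ z (j + L) ])) ⟩
      z (j + suc L) ∷ reverse (w ∷ʳ z (j + L))           ≡⟨ sym (reverse-++ (w ∷ʳ z (j + L)) [ z (j + suc L) ]) ⟩
      reverse ((w ∷ʳ z (j + L)) ∷ʳ z (j + suc L))         ≡⟨ cong (λ u → reverse (u ∷ʳ z (j + suc L))) (sym (factor-suc j L)) ⟩
      reverse (factor z j (suc L) ∷ʳ z (j + suc L))       ≡⟨ cong reverse (sym (factor-suc j (suc L))) ⟩
      reverse (factor z j (suc (suc L)))                  ≡⟨ pal ⟩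
      factor z j (suc (suc L))                            ∎

  OldPalindromicSuffixes : ℕ → Set
  OldPalindromicSuffixes n = ∀ j L → j + L ≡ suc n → Palindrome (factor z j L) → factor z j L ∈ factors (factor z 0 n)

  Rich⇒¬OldPalindromicSuffixes : Rich z → ∀ n → ¬ OldPalindromicSuffixes n
  Rich⇒¬OldPalindromicSuffixes rich n old = 1+n≰n (subst₂ _≤_ (rich 0 (suc n)) (rich 0 n) fewer)
    where
    old-suffix : ∀ p s → p ++ s ≡ factor z 0 n ∷ʳ z n → Palindrome s → s ∈ factors (factor z 0 n)
    old-suffix p s suf pal = subst (λ t → t ∈ factors (factor z 0 n)) (sym s≡)
                               (old (length p) (length s) p+s≡ (subst Palindrome s≡ pal))
      where
      suf′ : p ++ s ≡ factor z 0 (suc n)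
      suf′ = trans suf (sym (factor-suc 0 n))
      s≡ : s ≡ factor z (length p) (length s)
      s≡ = suffix-of-factor p s 0 (suc n) suf′
      p+s≡ : length p + length s ≡ suc n
      p+s≡ = trans (sym (length-++ p)) (trans (cong length suf′) (length-factor 0 (suc n)))
    fewer : length (palFactors (factor z 0 (suc n))) ≤ length (palFactors (factor z 0 n))
    fewer = subst (λ u → length (palFactors u) ≤ length (palFactors (factor z 0 n))) (sym (factor-suc 0 n))
              (palFactors-∷ʳ-≤ (factor z 0 n) (z n) old-suffix)

one two : Σ₃
one = suc zero
two = suc (suc zero)

Is12or21 : Σ₃ → Σ₃ → Set
Is12or21 x y = (x ≡ one × y ≡ two) ⊎ (x ≡ two × y ≡ one)

Is12or21-sym : ∀ {x y} → Is12or21 x y → Is12or21 y x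
Is12or21-sym (inj₁ (x≡ , y≡)) = inj₂ (y≡ , x≡)
Is12or21-sym (inj₂ (x≡ , y≡)) = inj₁ (y≡ , x≡)

Is12or21-irrefl : ∀ x → ¬ Is12or21 x x
Is12or21-irrefl x (inj₁ (refl , ()))
Is12or21-irrefl x (inj₂ (refl , ()))

Is12or21⇒≢0ˡ : ∀ {x y} → Is12or21 x y → x ≢ zero
Is12or21⇒≢0ˡ (inj₁ (refl , _)) ()
Is12or21⇒≢0ˡ (inj₂ (refl , _)) ()

Is12or21⇒≢0ʳ : ∀ {x y} → Is12or21 x y → y ≢ zero
Is12or21⇒≢0ʳ b = Is12or21⇒≢0ˡ (Is12or21-sym b)

module _ (z : InfWord) (rich : Rich z) (prefix : factor z 0 6 ≡ zero ∷ zero ∷ one ∷ zero ∷ zero ∷ two ∷ []) where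

  ¬12or21-before-5 : ∀ i → i < 5 → ¬ Is12or21 (z i) (z (suc i))
  ¬12or21-before-5 i i<5 b with ≡⇒Pointwise-≡ prefix
  ¬12or21-before-5 0 _ b | z0 ∷ _                     = Is12or21⇒≢0ˡ b z0
  ¬12or21-before-5 1 _ b | _ ∷ z1 ∷ _                 = Is12or21⇒≢0ˡ b z1
  ¬12or21-before-5 2 _ b | _ ∷ _ ∷ _ ∷ z3 ∷ _         = Is12or21⇒≢0ʳ b z3
  ¬12or21-before-5 3 _ b | _ ∷ _ ∷ _ ∷ z3 ∷ _         = Is12or21⇒≢0ˡ b z3
  ¬12or21-before-5 4 _ b | _ ∷ _ ∷ _ ∷ _ ∷ z4 ∷ _     = Is12or21⇒≢0ˡ b z4
  ¬12or21-before-5 (suc (suc (suc (suc (suc _))))) (s≤s (s≤s (s≤s (s≤s (s≤s ()))))) b | _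

  second-letter-in-prefix : ∀ {x y} → Is12or21 x y → ∃ λ k → k < 6 × z k ≡ y
  second-letter-in-prefix b with ≡⇒Pointwise-≡ prefix
  second-letter-in-prefix (inj₁ (_ , refl)) | _ ∷ _ ∷ _ ∷ _ ∷ _ ∷ z5 ∷ [] = 5 , ≤-refl , z5
  second-letter-in-prefix (inj₂ (_ , refl)) | _ ∷ _ ∷ z2 ∷ _             = 2 , s≤s (s≤s (s≤s z≤n)) , z2

  first-12or21⇒OldPalindromicSuffixes : ∀ I → 5 ≤ I → (∀ {j} → j < I → ¬ Is12or21 (z j) (z (suc j)))
                                      → Is12or21 (z I) (z (suc I)) → OldPalindromicSuffixes z (suc I)
  first-12or21⇒OldPalindromicSuffixes I 5≤I earlier b j zero j+L≡ pal = here refl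
  first-12or21⇒OldPalindromicSuffixes I 5≤I earlier b j (suc zero) j+1≡ pal
    with k , k<6 , zk≡ ← second-letter-in-prefix b
    = subst (λ c → [ c ] ∈ factors (factor z 0 (suc I))) (trans zk≡ (cong z (sym j≡)))
        (factor∈factors-prefix z k 1 (suc I) (subst (_≤ suc I) (+-comm 1 k) (≤-trans k<6 (s≤s 5≤I))))
    where
    j≡ : j ≡ suc I
    j≡ = suc-injective (trans (+-comm 1 j) j+1≡)
  first-12or21⇒OldPalindromicSuffixes I 5≤I earlier b j (suc (suc L)) j+L≡ pal = ⊥-elim (not-a-palindrome L refl)
    where
    j+sL≡ : j + suc L ≡ suc I
    j+sL≡ = suc-injective (trans (sym (+-suc j (suc L))) j+L≡)
    j+L≡I : j + L ≡ I
    j+L≡I = suc-injective (trans (sym (+-suc j L)) j+sL≡)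
    ends : z (j + suc L) ≡ z j × z (j + L) ≡ z (suc j)
    ends = palindrome-ends z j L pal
    reversed : Is12or21 (z (suc j)) (z j)
    reversed = subst₂ Is12or21 (proj₂ ends) (proj₁ ends)
                 (subst₂ (λ a c → Is12or21 (z a) (z c)) (sym j+L≡I) (sym j+sL≡) b)
    not-a-palindrome : ∀ L′ → L′ ≡ L → ⊥
    not-a-palindrome zero     refl = Is12or21-irrefl (z j)
                                       (subst (λ c → Is12or21 c (z j)) (trans (sym (proj₂ ends)) (cong z (+-identityʳ j))) reversed)
    not-a-palindrome (suc L′) refl = earlier (subst (j <_) j+L≡I (m<m+n j (s≤s z≤n))) (Is12or21-sym reversed)

  ¬12or21 : ∀ i → ¬ Is12or21 (z i) (z (suc i))
  ¬12or21 = <-rec (λ i → ¬ Is12or21 (z i) (z (suc i))) step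
    where
    step : ∀ i → (∀ {j} → j < i → ¬ Is12or21 (z j) (z (suc j))) → ¬ Is12or21 (z i) (z (suc i))
    step i earlier b with i <? 5
    ... | yes i<5 = ¬12or21-before-5 i i<5 b
    ... | no  i≮5 = Rich⇒¬OldPalindromicSuffixes z rich (suc i)
                      (first-12or21⇒OldPalindromicSuffixes i (≮⇒≥ i≮5) earlier b)

factor-2-letters : ∀ (z : InfWord) i {x y} → factor z i 2 ≡ x ∷ y ∷ [] → z i ≡ x × z (suc i) ≡ y
factor-2-letters z i eq with zi≡ ∷ zsi≡ ∷ [] ← ≡⇒Pointwise-≡ eq = zi≡ , zsi≡

lemma4 : (z : InfWord) → Rich z → PowerFree7/3 z
         → factor z 0 6 ≡ (zero ∷ zero ∷ suc zero ∷ zero ∷ zero ∷ suc (suc zero) ∷ [])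
         → ¬ HasFactor z (suc zero ∷ suc (suc zero) ∷ []) × ¬ HasFactor z (suc (suc zero) ∷ suc zero ∷ [])
lemma4 z rich _ prefix =
  (λ (i , eq) → ¬12or21 z rich prefix i (inj₁ (factor-2-letters z i eq))) ,
  (λ (i , eq) → ¬12or21 z rich prefix i (inj₂ (factor-2-letters z i eq)))
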